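{- Let $i,j\in[n-1]$ be nonconsecutive (i.e. $|i-j|\ne 1$). If $\pi=\pi_1\cdots\pi_n\in\mathfrak{S}_n$, viewed as the tuple $(\pi_1,\ldots,\pi_n)\in\mathrm{UFR}_n$, then $\delta_i(\delta_j(\pi))=\delta_j(\delta_i(\pi))$.
   Context: $[n]=\{1,\ldots,n\}$. Parking process: $\alpha=(a_1,\ldots,a_n)\in[n]^n$ encodes preferences of cars $1,\ldots,n$ arriving in order at a one-way street with spots $1,\ldots,n$; car $i$ parks in spot $a_i$ if free, otherwise in the first free spot after $a_i$, if any. $\alpha$ is a parking function if all cars park. A unit interval parking function is a parking function in which each car $i$ parks in spot $a_i$ or $a_i+1$. A Fubini ranking is a tuple $(r_1,\ldots,r_n)\in[n]^n$ with $r_i=1+|\{j:r_j<r_i\}|$ for all $i$. $\mathrm{UFR}_n$ is the set of tuples that are both Fubini rankings and unit interval parking functions (unit Fubini rankings); every permutation in one-line notation belongs to it. For $i\in[n-1]$, $\delta_i:\mathrm{UFR}_n\to\mathrm{UFR}_n$ is defined by $\delta_i(\alpha)=\alpha$ if some value among $i-1,i,i+1$ occurs exactly twice in $\alpha$, and otherwise $\delta_i(\alpha)$ is obtained from $\alpha$ by decreasing the single occurrence of $i+1$ to $i$. -}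

module Defs where

open import Data.Nat using (ℕ; zero; suc; _≤_; _∸_; _≟_)
open import Data.Bool using (Bool; true; false; if_then_else_; _∨_)
open import Data.Vec using (Vec; []; _∷_; map; toList)
open import Data.Product using (_×_)
open import Data.List.Relation.Unary.All using (All)
open import Data.List.Relation.Unary.Unique.Propositional using (Unique)
open import Relation.Nullary.Decidable using (⌊_⌋)

count : ∀ {n} → ℕ → Vec ℕ n → ℕ
count x [] = 0
count x (y ∷ v) = if ⌊ x ≟ y ⌋ then suc (count x v) else count x v

twice : ∀ {n} → ℕ → Vec ℕ n → Bool
twice x v = ⌊ count x v ≟ 2 ⌋

δ : ∀ {n} → ℕ → Vec ℕ n → Vec ℕ n
δ i α =
  if twice (i ∸ 1) α ∨ twice i α ∨ twice (suc i) α
  then α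
  else map (λ a → if ⌊ a ≟ suc i ⌋ then i else a) α

IsPermutation : ∀ n → Vec ℕ n → Set
IsPermutation n π = All (λ a → 1 ≤ a × a ≤ n) (toList π) × Unique (toList π)

{-# OPTIONS --safe #-}
-- On a permutation every value occurs at most once, so δ_k never hits its
-- identity case and acts as the relabelling lower k : k+1 ↦ k.  After lower j
-- only the value j can occur twice, and for nonconsecutive i ≠ j none of
-- i-1, i, i+1 equals j, so δ_i (δ_j π) = lower i (lower j π).  Two such
-- relabellings commute pointwise, which gives the theorem.
module Submission where

open import Defs
open import Data.Nat using (ℕ; zero; suc; pred; _≤_; _∸_; _≟_; z≤n; s≤s)
open import Data.Nat.Properties using (≤-trans; m≤n⇒m≤1+n; suc-injective)
open import Data.Bool using (false; if_then_else_)
open import Data.Vec using (Vec; []; _∷_; map; toList)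
open import Data.Vec.Properties using (map-∘; map-cong)
open import Data.Product using (_,_)
open import Data.Empty using (⊥-elim)
open import Data.List.Relation.Unary.All using (All; _∷_)
open import Data.List.Relation.Unary.AllPairs using (_∷_)
open import Data.List.Relation.Unary.Unique.Propositional using (Unique)
open import Relation.Nullary using (yes; no)
open import Relation.Nullary.Decidable using (⌊_⌋)
open import Relation.Binary.PropositionalEquality
  using (_≡_; _≢_; refl; sym; trans; cong; subst; module ≡-Reasoning)

lower : ℕ → ℕ → ℕ
lower k a = if ⌊ a ≟ suc k ⌋ then k else a

lower-suc : ∀ k → lower k (suc k) ≡ k
lower-suc k with suc k ≟ suc k
... | yes _ = refl
... | no ≢ = ⊥-elim (≢ refl)

lower-≢ : ∀ {k a} → a ≢ suc k → lower k a ≡ a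
lower-≢ {k} {a} a≢ with a ≟ suc k
... | yes a≡ = ⊥-elim (a≢ a≡)
... | no _ = refl

lower-preimage : ∀ {k x} y → x ≢ k → lower k y ≡ x → y ≡ x
lower-preimage {k} y x≢k eq with y ≟ suc k
... | yes _ = ⊥-elim (x≢k (sym eq))
... | no _ = eq

lower-comm : ∀ {i j} → i ≢ suc j → j ≢ suc i →
  ∀ a → lower i (lower j a) ≡ lower j (lower i a)
lower-comm {i} {j} i≢ j≢ a with a ≟ suc j | a ≟ suc i
... | yes refl | yes eq rewrite suc-injective eq = refl
... | yes refl | no _ rewrite lower-suc j | lower-≢ j≢ = refl
... | no _ | yes refl rewrite lower-suc i | lower-≢ i≢ = refl
... | no a≢j | no a≢i rewrite lower-≢ a≢j | lower-≢ a≢i = refl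

map-lower-comm : ∀ {n i j} → i ≢ suc j → j ≢ suc i → (v : Vec ℕ n) →
  map (lower i) (map (lower j) v) ≡ map (lower j) (map (lower i) v)
map-lower-comm i≢ j≢ v = trans (sym (map-∘ _ _ v))
  (trans (map-cong (lower-comm i≢ j≢) v) (map-∘ _ _ v))

count-absent : ∀ {n} x (v : Vec ℕ n) → All (x ≢_) (toList v) → count x v ≡ 0
count-absent x [] _ = refl
count-absent x (y ∷ v) (x≢y ∷ rest) with x ≟ y
... | yes x≡y = ⊥-elim (x≢y x≡y)
... | no _ = count-absent x v rest

unique⇒count≤1 : ∀ {n} (v : Vec ℕ n) → Unique (toList v) → ∀ x → count x v ≤ 1
unique⇒count≤1 [] _ x = z≤n
unique⇒count≤1 (y ∷ v) (y∉v ∷ u) x with x ≟ y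
... | yes refl rewrite count-absent x v y∉v = s≤s z≤n
... | no _ = unique⇒count≤1 v u x

count-map-≤ : ∀ {n} (g : ℕ → ℕ) x → (∀ y → g y ≡ x → y ≡ x) →
  (v : Vec ℕ n) → count x (map g v) ≤ count x v
count-map-≤ g x pre [] = z≤n
count-map-≤ g x pre (y ∷ v) with x ≟ g y | x ≟ y
... | yes _ | yes _ = s≤s (count-map-≤ g x pre v)
... | yes x≡gy | no x≢y = ⊥-elim (x≢y (sym (pre y (sym x≡gy))))
... | no _ | yes _ = m≤n⇒m≤1+n (count-map-≤ g x pre v)
... | no _ | no _ = count-map-≤ g x pre v

count≤1⇒¬twice : ∀ {n x} (v : Vec ℕ n) → count x v ≤ 1 → twice x v ≡ false
count≤1⇒¬twice {x = x} v ≤1 with count x v ≟ 2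
... | no _ = refl
... | yes c≡2 with subst (_≤ 1) c≡2 ≤1
...   | s≤s ()

δ≡map-lower : ∀ {n} k (v : Vec ℕ n) →
  count (k ∸ 1) v ≤ 1 → count k v ≤ 1 → count (suc k) v ≤ 1 →
  δ k v ≡ map (lower k) v
δ≡map-lower k v c₋ c c₊
  rewrite count≤1⇒¬twice v c₋ | count≤1⇒¬twice v c | count≤1⇒¬twice v c₊ = refl

δ-unique : ∀ {n} k (v : Vec ℕ n) → Unique (toList v) → δ k v ≡ map (lower k) v
δ-unique k v u = δ≡map-lower k v (≤1 _) (≤1 _) (≤1 _)
  where ≤1 = unique⇒count≤1 v u

pred≢ : ∀ {i j} → i ≢ j → i ≢ suc j → pred i ≢ j
pred≢ {zero} i≢j _ = i≢j
pred≢ {suc i} _ i≢ = λ eq → i≢ (cong suc eq)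

δ-δ-unique : ∀ {n} i j → i ≢ j → i ≢ suc j → j ≢ suc i →
  (π : Vec ℕ n) → Unique (toList π) →
  δ i (δ j π) ≡ map (lower i) (map (lower j) π)
δ-δ-unique i j i≢j i≢ j≢ π u rewrite δ-unique j π u =
  δ≡map-lower i (map (lower j) π)
    (≤1 (pred≢ i≢j i≢)) (≤1 i≢j) (≤1 (λ eq → j≢ (sym eq)))
  where
  ≤1 : ∀ {x} → x ≢ j → count x (map (lower j) π) ≤ 1
  ≤1 {x} x≢j = ≤-trans (count-map-≤ (lower j) x (λ y → lower-preimage y x≢j) π)
                       (unique⇒count≤1 π u x)

theorem3p11 : (n i j : ℕ) → 1 ≤ i → i ≤ n ∸ 1 → 1 ≤ j → j ≤ n ∸ 1 →
    i ≢ suc j → j ≢ suc i →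
    (π : Vec ℕ n) → IsPermutation n π →
    δ i (δ j π) ≡ δ j (δ i π)
theorem3p11 n i j _ _ _ _ i≢ j≢ π (_ , u) with i ≟ j
... | yes refl = refl
... | no i≢j = begin
  δ i (δ j π)                       ≡⟨ δ-δ-unique i j i≢j i≢ j≢ π u ⟩
  map (lower i) (map (lower j) π)   ≡⟨ map-lower-comm i≢ j≢ π ⟩
  map (lower j) (map (lower i) π)   ≡⟨ sym (δ-δ-unique j i (λ eq → i≢j (sym eq)) j≢ i≢ π u) ⟩
  δ j (δ i π)                       ∎
  where open ≡-Reasoning
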